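{- Let $Y$ be a computable set (e.g. $Y=\omega$ or a computable subset of $\omega$), and let $X \subseteq \mathcal{P}_{<\omega}(Y)$ be such that there is $n\in\omega$ with $|x| \leq n$ for all $x \in X$. Then there are a set $X^* \subseteq \mathcal{P}_{n}\big(Y \times \{0\} \cup \omega \times \{1\}\big)$ and a bijection $i\colon X \to X^*$ such that: (1) $X^*$ and $i$ are computable from $X$; (2) for every $x \in X$, $\{(a, 0) : a \in x\} = i(x) \cap (Y \times \{0\})$; (3) for every $X_0 \subseteq X$, $X_0$ is a sunflower if and only if $\{i(x) : x\in X_0\}$ is a sunflower; and in particular for any distinct $x, y \in X$, $i(x) \cap i(y) = \{(a, 0) : a \in x \cap y\}$.
   Context: For a set $Z$, $\mathcal{P}_{<\omega}(Z)$ denotes the set of finite subsets of $Z$ and $\mathcal{P}_n(Z)$ the set of subsets of $Z$ of size exactly $n$. Finite subsets of computable sets are coded by natural numbers via a fixed coding from which membership and cardinality are computable. A sunflower is a collection $X_0$ of finite sets for which there is a set $r$ such that $p\cap q = r$ for all distinct $p,q\in X_0$. -}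

module Defs where

open import Data.Nat using (ℕ; zero; suc; _+_; _*_; _^_; _≤_)
open import Data.Nat.DivMod using (_/_; _%_)
open import Data.Nat.Properties using (_≟_)
open import Data.Bool using (Bool; true; false)
open import Data.List using (List; length; filter; upTo)
open import Data.Product using (Σ; Σ-syntax; ∃; ∃-syntax; _×_; _,_)
open import Relation.Nullary using (¬_)
open import Relation.Binary.PropositionalEquality using (_≡_; _≢_)
open import Function.Bundles using (_⇔_)
open import Level using (0ℓ)

-- Fixed coding of finite subsets of ℕ by natural numbers (Ackermann coding):
-- the code c represents the set { a | bit a of c is 1 }.
bit : ℕ → ℕ → ℕ
bit zero    c = c % 2
bit (suc a) c = bit a (c / 2)

_∈c_ : ℕ → ℕ → Set
a ∈c c = bit a c ≡ 1

-- cardinality of the finite set coded by c (all elements of c are < c)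
card : ℕ → ℕ
card c = length (filter (λ a → bit a c ≟ 1) (upTo c))

-- Fixed coding of the disjoint union  ω × {0} ∪ ω × {1}  into ℕ:
-- (a , 0) ↦ 2a  and  (a , 1) ↦ 2a + 1.
tag0 : ℕ → ℕ
tag0 a = 2 * a

tag1 : ℕ → ℕ
tag1 a = 2 * a + 1

Sunflower : (ℕ → Set) → Set₁
Sunflower S = Σ[ r ∈ (ℕ → Set) ]
  (∀ p q → S p → S q → p ≢ q → ∀ e → ((e ∈c p × e ∈c q) ⇔ r e))

-- Send x to its tag-0 copy together with n ∸ |x| tag-1 points taken from the interval
-- [x·n, (x+1)·n), which is reserved for x alone. These intervals are pairwise disjoint, so the
-- images of distinct x, y meet exactly in the tag-0 copy of x ∩ y; both the intersection
-- formula and the transfer of sunflowers follow from this, and decoding the tag-0 part inverts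
-- the embedding, which makes the image X* decidable from X.
module Submission where

open import Defs
open import Data.Nat using (ℕ; _+_; _*_; _≤_)
open import Data.Bool using (Bool; true; false)
open import Data.Product using (Σ; Σ-syntax; ∃; ∃-syntax; _×_; _,_)
open import Data.Sum using (_⊎_)
open import Relation.Binary.PropositionalEquality using (_≡_; _≢_)
open import Function.Bundles using (_⇔_)

open import Data.Nat using (zero; suc; _∸_; _<_; z≤n; s≤s)
open import Data.Nat.Properties
open import Data.Nat.DivMod
open import Data.Nat.Divisibility using (divides-refl)
open import Algebra.Properties.CommutativeSemigroup +-commutativeSemigroup using (interchange)
open import Data.List using (length; filter; applyUpTo)
open import Data.List.Properties using (filter-accept; filter-reject)
open import Data.Bool using (_∧_)
open import Data.Sum using (inj₁; inj₂)
open import Data.Product using (proj₁; proj₂)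
open import Data.Empty using (⊥; ⊥-elim)
open import Function.Base using (_∘_; _$_)
open import Function.Definitions using (Injective)
open import Function.Bundles using (mk⇔; Equivalence)
open import Relation.Nullary using (yes; no)
open import Relation.Nullary.Decidable using (⌊_⌋)
open import Relation.Binary.PropositionalEquality
  using (refl; sym; trans; cong; cong₂; subst; module ≡-Reasoning)
open import Relation.Binary.Definitions using (tri<; tri≈; tri>)

open ≡-Reasoning
open Equivalence using (to; from)

digit-%2 : ∀ {b} r → b ≤ 1 → (b + r * 2) % 2 ≡ b
digit-%2 {b} r b≤1 = trans ([m+kn]%n≡m%n b r 2) (m<n⇒m%n≡m (s≤s b≤1))

digit-/2 : ∀ {b} r → b ≤ 1 → (b + r * 2) / 2 ≡ r
digit-/2 {b} r b≤1 = begin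
  (b + r * 2) / 2    ≡⟨ +-distrib-/-∣ʳ b (divides-refl r) ⟩
  b / 2 + r * 2 / 2  ≡⟨ cong₂ _+_ (m<n⇒m/n≡0 (s≤s b≤1)) (m*n/n≡m r 2) ⟩
  r                  ∎

m≤1+n⇒m/2≤n : ∀ {c a} → c ≤ suc a → c / 2 ≤ a
m≤1+n⇒m/2≤n {zero}  _          = z≤n
m≤1+n⇒m/2≤n {suc c} (s≤s c≤a) = ≤-trans (≤-pred (m/n<m (suc c) 2 (s≤s (s≤s z≤n)))) c≤a

bit≤1 : ∀ a c → bit a c ≤ 1
bit≤1 zero    c = ≤-pred (m%n<n c 2)
bit≤1 (suc a) c = bit≤1 a (c / 2)

bit-outOfRange : ∀ {a c} → c ≤ a → bit a c ≡ 0
bit-outOfRange {zero}  z≤n = refl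
bit-outOfRange {suc a} c≤a = bit-outOfRange {a} (m≤1+n⇒m/2≤n c≤a)

fromBits : (ℕ → ℕ) → ℕ → ℕ
fromBits f zero    = 0
fromBits f (suc K) = f 0 + fromBits (f ∘ suc) K * 2

bit-fromBits : ∀ K {f} → (∀ a → f a ≤ 1) → (∀ a → K ≤ a → f a ≡ 0) →
               ∀ a → bit a (fromBits f K) ≡ f a
bit-fromBits zero        f≤1 f≡0 a       = trans (bit-outOfRange {a} z≤n) (sym (f≡0 a z≤n))
bit-fromBits (suc K) {f} f≤1 f≡0 zero    = digit-%2 (fromBits (f ∘ suc) K) (f≤1 0)
bit-fromBits (suc K) {f} f≤1 f≡0 (suc a) =
  trans (cong (bit a) (digit-/2 (fromBits (f ∘ suc) K) (f≤1 0)))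
        (bit-fromBits K (f≤1 ∘ suc) (λ b K≤b → f≡0 (suc b) (s≤s K≤b)) a)

fromBits-bit : ∀ {K c} → c ≤ K → fromBits (λ a → bit a c) K ≡ c
fromBits-bit {zero}  z≤n = refl
fromBits-bit {suc K} {c} c≤K = begin
  c % 2 + fromBits (λ a → bit a (c / 2)) K * 2  ≡⟨ cong (λ w → c % 2 + w * 2) (fromBits-bit (m≤1+n⇒m/2≤n c≤K)) ⟩
  c % 2 + c / 2 * 2                              ≡⟨ sym (m≡m%n+[m/n]*n c 2) ⟩
  c                                              ∎

fromBits-cong : ∀ K {f g} → (∀ a → f a ≡ g a) → fromBits f K ≡ fromBits g K
fromBits-cong zero    f≡g = refl
fromBits-cong (suc K) f≡g = cong₂ (λ u v → u + v * 2) (f≡g 0) (fromBits-cong K (f≡g ∘ suc))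

bit-extensionality : ∀ {c d} → (∀ a → bit a c ≡ bit a d) → c ≡ d
bit-extensionality {c} {d} c≗d = begin
  c                                   ≡⟨ sym (fromBits-bit (m≤m+n c d)) ⟩
  fromBits (λ a → bit a c) (c + d)   ≡⟨ fromBits-cong (c + d) c≗d ⟩
  fromBits (λ a → bit a d) (c + d)   ≡⟨ fromBits-bit (m≤n+m d c) ⟩
  d                                   ∎

isOne : ℕ → ℕ
isOne (suc zero) = 1
isOne _          = 0

isOne-≢1 : ∀ {v} → v ≢ 1 → isOne v ≡ 0
isOne-≢1 {zero}        _   = refl
isOne-≢1 {suc zero}    v≢1 = ⊥-elim (v≢1 refl)
isOne-≢1 {suc (suc v)} _   = refl

ones : (ℕ → ℕ) → ℕ → ℕ
ones f zero    = 0
ones f (suc B) = isOne (f 0) + ones (f ∘ suc) B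

ones-cong : ∀ B {f g} → (∀ a → f a ≡ g a) → ones f B ≡ ones g B
ones-cong zero    f≡g = refl
ones-cong (suc B) f≡g = cong₂ _+_ (cong isOne (f≡g 0)) (ones-cong B (f≡g ∘ suc))

ones-≡0 : ∀ B {f} → (∀ a → f a ≡ 0) → ones f B ≡ 0
ones-≡0 zero    f≡0 = refl
ones-≡0 (suc B) f≡0 = cong₂ _+_ (cong isOne (f≡0 0)) (ones-≡0 B (f≡0 ∘ suc))

ones-extend : ∀ {B B'} f → B ≤ B' → (∀ a → B ≤ a → f a ≡ 0) → ones f B' ≡ ones f B
ones-extend {zero}  {B'}     f _          f≡0 = ones-≡0 B' (λ a → f≡0 a z≤n)
ones-extend {suc B} {suc B'} f (s≤s B≤B') f≡0 =
  cong (isOne (f 0) +_) (ones-extend (f ∘ suc) B≤B' (λ a B≤a → f≡0 (suc a) (s≤s B≤a)))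

ones-bound-irrelevant : ∀ {B B'} f → (∀ a → B ≤ a → f a ≡ 0) → (∀ a → B' ≤ a → f a ≡ 0) →
                        ones f B ≡ ones f B'
ones-bound-irrelevant {B} {B'} f f≡0 f≡0' =
  trans (sym (ones-extend f (m≤m⊔n B B') f≡0)) (ones-extend f (m≤n⊔m B B') f≡0')

length-filter-applyUpTo : ∀ (f g : ℕ → ℕ) B →
  length (filter (λ a → f a ≟ 1) (applyUpTo g B)) ≡ ones (f ∘ g) B
length-filter-applyUpTo f g zero = refl
length-filter-applyUpTo f g (suc B) with f (g 0) ≟ 1
... | yes p = trans (cong length (filter-accept (λ a → f a ≟ 1) {xs = applyUpTo (g ∘ suc) B} p))
  (cong₂ _+_ (sym (cong isOne p)) (length-filter-applyUpTo f (g ∘ suc) B))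
... | no ¬p = trans (cong length (filter-reject (λ a → f a ≟ 1) {xs = applyUpTo (g ∘ suc) B} ¬p))
  (trans (length-filter-applyUpTo f (g ∘ suc) B) (cong (_+ ones (f ∘ g ∘ suc) B) (sym (isOne-≢1 ¬p))))

card≡ones : ∀ {c B} → c ≤ B → card c ≡ ones (λ a → bit a c) B
card≡ones {c} c≤B = trans (length-filter-applyUpTo (λ a → bit a c) (λ a → a) c)
  (ones-bound-irrelevant _ (λ a → bit-outOfRange) (λ a B≤a → bit-outOfRange (≤-trans c≤B B≤a)))

card-fromBits : ∀ K {f} → (∀ a → f a ≤ 1) → (∀ a → K ≤ a → f a ≡ 0) → card (fromBits f K) ≡ ones f K
card-fromBits K {f} f≤1 f≡0 = begin
  card (fromBits f K)                                ≡⟨ card≡ones {fromBits f K} ≤-refl ⟩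
  ones (λ a → bit a (fromBits f K)) (fromBits f K)  ≡⟨ ones-bound-irrelevant _ (λ a → bit-outOfRange) f≡0' ⟩
  ones (λ a → bit a (fromBits f K)) K                ≡⟨ ones-cong K (bit-fromBits K f≤1 f≡0) ⟩
  ones f K                                           ∎
  where
  f≡0' : ∀ a → K ≤ a → bit a (fromBits f K) ≡ 0
  f≡0' a K≤a = trans (bit-fromBits K f≤1 f≡0 a) (f≡0 a K≤a)

interval : ℕ → ℕ → ℕ → ℕ
interval zero    zero    m       = 0
interval zero    (suc l) zero    = 1
interval zero    (suc l) (suc m) = interval zero l m
interval (suc s) l       zero    = 0
interval (suc s) l       (suc m) = interval s l m

interval≤1 : ∀ s l m → interval s l m ≤ 1
interval≤1 zero    zero    m       = z≤n
interval≤1 zero    (suc l) zero    = s≤s z≤n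
interval≤1 zero    (suc l) (suc m) = interval≤1 zero l m
interval≤1 (suc s) l       zero    = z≤n
interval≤1 (suc s) l       (suc m) = interval≤1 s l m

interval-outOfRange : ∀ s l {m} → s + l ≤ m → interval s l m ≡ 0
interval-outOfRange zero    zero    _           = refl
interval-outOfRange zero    (suc l) (s≤s l≤m)   = interval-outOfRange zero l l≤m
interval-outOfRange (suc s) l       (s≤s s+l≤m) = interval-outOfRange s l s+l≤m

interval-∈ : ∀ s l m → interval s l m ≡ 1 → s ≤ m × m < s + l
interval-∈ zero    (suc l) zero    _  = z≤n , s≤s z≤n
interval-∈ zero    (suc l) (suc m) eq = z≤n , s≤s (proj₂ (interval-∈ zero l m eq))
interval-∈ (suc s) l       (suc m) eq =
  let s≤m , m<s+l = interval-∈ s l m eq in s≤s s≤m , s≤s m<s+l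

ones-interval : ∀ s l B → s + l ≤ B → ones (interval s l) B ≡ l
ones-interval zero    zero    B       _            = ones-≡0 B (λ _ → refl)
ones-interval zero    (suc l) (suc B) (s≤s l≤B)   = cong suc (ones-interval zero l B l≤B)
ones-interval (suc s) l       (suc B) (s≤s s+l≤B) = ones-interval s l B s+l≤B

interleave : (ℕ → ℕ) → (ℕ → ℕ) → ℕ → ℕ
interleave h k zero          = h 0
interleave h k (suc zero)    = k 0
interleave h k (suc (suc e)) = interleave (h ∘ suc) (k ∘ suc) e

interleave-tag0 : ∀ a h k → interleave h k (tag0 a) ≡ h a
interleave-tag0 zero    h k = refl
interleave-tag0 (suc a) h k rewrite *-suc 2 a = interleave-tag0 a (h ∘ suc) (k ∘ suc)

interleave-tag1 : ∀ a h k → interleave h k (tag1 a) ≡ k a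
interleave-tag1 zero    h k = refl
interleave-tag1 (suc a) h k =
  trans (cong (λ w → interleave h k (w + 1)) (*-suc 2 a)) (interleave-tag1 a (h ∘ suc) (k ∘ suc))

tag0-or-tag1 : ∀ e → Σ[ a ∈ ℕ ] (e ≡ tag0 a ⊎ e ≡ tag1 a)
tag0-or-tag1 zero = 0 , inj₁ refl
tag0-or-tag1 (suc e) with tag0-or-tag1 e
... | a , inj₁ refl = a , inj₂ (+-comm 1 (2 * a))
... | a , inj₂ refl = suc a , inj₁ (trans (cong suc (+-comm (2 * a) 1)) (sym (*-suc 2 a)))

tag0-injective : Injective _≡_ _≡_ tag0
tag0-injective {a} {b} = *-cancelˡ-≡ a b 2

tag0≤tag1⇒≤ : ∀ {a b} → tag0 b ≤ tag1 a → b ≤ a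
tag0≤tag1⇒≤ {a} {b} 2b≤2a+1 = ≤-pred (*-cancelˡ-< 2 b (suc a)
  (≤-trans (s≤s 2b≤2a+1) (≤-reflexive (trans (cong suc (+-comm (2 * a) 1)) (sym (*-suc 2 a))))))

interleave≤1 : ∀ {h k} → (∀ a → h a ≤ 1) → (∀ a → k a ≤ 1) → ∀ e → interleave h k e ≤ 1
interleave≤1 {h} {k} h≤1 k≤1 e with tag0-or-tag1 e
... | a , inj₁ refl = subst (_≤ 1) (sym (interleave-tag0 a h k)) (h≤1 a)
... | a , inj₂ refl = subst (_≤ 1) (sym (interleave-tag1 a h k)) (k≤1 a)

interleave-outOfRange : ∀ {B h k} → (∀ a → B ≤ a → h a ≡ 0) → (∀ a → B ≤ a → k a ≡ 0) →
                        ∀ e → 2 * B ≤ e → interleave h k e ≡ 0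
interleave-outOfRange {B} {h} {k} h≡0 k≡0 e 2B≤e with tag0-or-tag1 e
... | a , inj₁ refl = trans (interleave-tag0 a h k) (h≡0 a (*-cancelˡ-≤ 2 2B≤e))
... | a , inj₂ refl = trans (interleave-tag1 a h k) (k≡0 a (tag0≤tag1⇒≤ 2B≤e))

ones-interleave : ∀ B h k → ones (interleave h k) (2 * B) ≡ ones h B + ones k B
ones-interleave zero    h k = refl
ones-interleave (suc B) h k = trans (cong (ones (interleave h k)) (*-suc 2 B)) $ begin
  p + (q + ones (interleave (h ∘ suc) (k ∘ suc)) (2 * B))
    ≡⟨ cong (λ w → p + (q + w)) (ones-interleave B (h ∘ suc) (k ∘ suc)) ⟩
  p + (q + (u + v))  ≡⟨ sym (+-assoc p q (u + v)) ⟩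
  (p + q) + (u + v)  ≡⟨ interchange p q u v ⟩
  (p + u) + (q + v)  ∎
  where
  p q u v : ℕ
  p = isOne (h 0)
  q = isOne (k 0)
  u = ones (h ∘ suc) B
  v = ones (k ∘ suc) B

Sunflower-image : ∀ (ι t : ℕ → ℕ) → Injective _≡_ _≡_ ι → Injective _≡_ _≡_ t →
  (∀ x y → x ≢ y → ∀ e → (e ∈c ι x × e ∈c ι y) ⇔ (Σ[ a ∈ ℕ ] (e ≡ t a × a ∈c x × a ∈c y))) →
  ∀ X₀ → Sunflower X₀ ⇔ Sunflower (λ z → Σ[ x ∈ ℕ ] (X₀ x × ι x ≡ z))
Sunflower-image ι t ι-injective t-injective ι-∩ X₀ = mk⇔ forward backward
  where
  Image : ℕ → Set
  Image z = Σ[ x ∈ ℕ ] (X₀ x × ι x ≡ z)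

  forward : Sunflower X₀ → Sunflower Image
  forward (r , core) = (λ e → Σ[ a ∈ ℕ ] (e ≡ t a × r a)) , imageCore
    where
    imageCore : ∀ p q → Image p → Image q → p ≢ q →
                ∀ e → (e ∈c p × e ∈c q) ⇔ (Σ[ a ∈ ℕ ] (e ≡ t a × r a))
    imageCore _ _ (x , x∈X₀ , refl) (y , y∈X₀ , refl) ιx≢ιy e = mk⇔
      (λ e∈both → let a , e≡ta , a∈x , a∈y = to (ι-∩ x y x≢y e) e∈both
                  in a , e≡ta , to (core x y x∈X₀ y∈X₀ x≢y a) (a∈x , a∈y))
      (λ (a , e≡ta , ra) → from (ι-∩ x y x≢y e) (a , e≡ta , from (core x y x∈X₀ y∈X₀ x≢y a) ra))
      where
      x≢y : x ≢ y
      x≢y = ιx≢ιy ∘ cong ι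

  backward : Sunflower Image → Sunflower X₀
  backward (r , core) = r ∘ t , preCore
    where
    preCore : ∀ x y → X₀ x → X₀ y → x ≢ y → ∀ a → (a ∈c x × a ∈c y) ⇔ r (t a)
    preCore x y x∈X₀ y∈X₀ x≢y a = mk⇔
      (λ (a∈x , a∈y) → to coreAt (from (ι-∩ x y x≢y (t a)) (a , refl , a∈x , a∈y)))
      (λ rta → let b , ta≡tb , b∈x , b∈y = to (ι-∩ x y x≢y (t a)) (from coreAt rta)
               in subst (λ c → c ∈c x × c ∈c y) (sym (t-injective ta≡tb)) (b∈x , b∈y))
      where
      coreAt : (t a ∈c ι x × t a ∈c ι y) ⇔ r (t a)
      coreAt = core (ι x) (ι y) (x , x∈X₀ , refl) (y , y∈X₀ , refl) (x≢y ∘ ι-injective) (t a)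

decode : ℕ → ℕ
decode z = fromBits (λ a → bit (tag0 a) z) z

bit-decode : ∀ a z → bit a (decode z) ≡ bit (tag0 a) z
bit-decode a z = bit-fromBits z (λ b → bit≤1 (tag0 b) z)
  (λ b z≤b → bit-outOfRange (≤-trans z≤b (m≤m+n b (b + 0)))) a

module Embedding (n : ℕ) where

  padding : ℕ → ℕ → ℕ
  padding x = interval (x * n) (n ∸ card x)

  padding-end : ∀ x → x * n + (n ∸ card x) ≤ suc x * n
  padding-end x = ≤-trans (+-monoʳ-≤ (x * n) (m∸n≤m n (card x))) (≤-reflexive (+-comm (x * n) n))

  padding-∈ : ∀ x m → padding x m ≡ 1 → x * n ≤ m × m < suc x * n
  padding-∈ x m m∈ = let xn≤m , m<end = interval-∈ (x * n) (n ∸ card x) m m∈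
                     in xn≤m , <-≤-trans m<end (padding-end x)

  padding-disjoint-< : ∀ {x y} m → x < y → padding x m ≡ 1 → padding y m ≡ 1 → ⊥
  padding-disjoint-< {x} {y} m x<y m∈x m∈y =
    <-irrefl refl (<-≤-trans m<end (≤-trans (*-monoˡ-≤ n x<y) yn≤m))
    where
    m<end : m < suc x * n
    m<end = proj₂ (padding-∈ x m m∈x)
    yn≤m : y * n ≤ m
    yn≤m = proj₁ (padding-∈ y m m∈y)

  padding-disjoint : ∀ {x y} m → x ≢ y → padding x m ≡ 1 → padding y m ≡ 1 → ⊥
  padding-disjoint {x} {y} m x≢y m∈x m∈y with <-cmp x y
  ... | tri< x<y _ _ = padding-disjoint-< m x<y m∈x m∈y
  ... | tri≈ _ x≡y _ = x≢y x≡y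
  ... | tri> _ _ y<x = padding-disjoint-< m y<x m∈y m∈x

  χ : ℕ → ℕ → ℕ
  χ x = interleave (λ a → bit a x) (padding x)

  bound : ℕ → ℕ
  bound x = x + suc x * n

  χ-outOfRange : ∀ x e → 2 * bound x ≤ e → χ x e ≡ 0
  χ-outOfRange x = interleave-outOfRange
    (λ a bound≤a → bit-outOfRange (≤-trans (m≤m+n x (suc x * n)) bound≤a))
    (λ a bound≤a → interval-outOfRange (x * n) (n ∸ card x)
                     (≤-trans (padding-end x) (≤-trans (m≤n+m (suc x * n) x) bound≤a)))

  χ≤1 : ∀ x e → χ x e ≤ 1
  χ≤1 x = interleave≤1 (λ a → bit≤1 a x) (interval≤1 (x * n) (n ∸ card x))

  embed : ℕ → ℕ
  embed x = fromBits (χ x) (2 * bound x)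

  bit-embed : ∀ x e → bit e (embed x) ≡ χ x e
  bit-embed x = bit-fromBits (2 * bound x) (χ≤1 x) (χ-outOfRange x)

  bit-tag0-embed : ∀ x a → bit (tag0 a) (embed x) ≡ bit a x
  bit-tag0-embed x a = trans (bit-embed x (tag0 a)) (interleave-tag0 a _ _)

  bit-tag1-embed : ∀ x a → bit (tag1 a) (embed x) ≡ padding x a
  bit-tag1-embed x a = trans (bit-embed x (tag1 a)) (interleave-tag1 a _ _)

  decode-embed : ∀ x → decode (embed x) ≡ x
  decode-embed x = bit-extensionality (λ a → trans (bit-decode a (embed x)) (bit-tag0-embed x a))

  embed-injective : Injective _≡_ _≡_ embed
  embed-injective {x} {y} ιx≡ιy = begin
    x                 ≡⟨ sym (decode-embed x) ⟩
    decode (embed x)  ≡⟨ cong decode ιx≡ιy ⟩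
    decode (embed y)  ≡⟨ decode-embed y ⟩
    y                 ∎

  card-embed : ∀ x → card x ≤ n → card (embed x) ≡ n
  card-embed x |x|≤n = begin
    card (embed x)            ≡⟨ card-fromBits (2 * bound x) (χ≤1 x) (χ-outOfRange x) ⟩
    ones (χ x) (2 * bound x)  ≡⟨ ones-interleave (bound x) _ _ ⟩
    ones (λ a → bit a x) (bound x) + ones (padding x) (bound x)
      ≡⟨ cong₂ _+_ (sym (card≡ones (m≤m+n x (suc x * n))))
                   (ones-interval (x * n) (n ∸ card x) (bound x) (≤-trans (padding-end x) (m≤n+m _ x))) ⟩
    card x + (n ∸ card x)     ≡⟨ m+[n∸m]≡n |x|≤n ⟩
    n                         ∎

  embed-∩ : ∀ x y → x ≢ y → ∀ e →
            (e ∈c embed x × e ∈c embed y) ⇔ (Σ[ a ∈ ℕ ] (e ≡ tag0 a × a ∈c x × a ∈c y))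
  embed-∩ x y x≢y e = mk⇔ common
    (λ { (a , refl , a∈x , a∈y) → trans (bit-tag0-embed x a) a∈x , trans (bit-tag0-embed y a) a∈y })
    where
    common : (e ∈c embed x × e ∈c embed y) → Σ[ a ∈ ℕ ] (e ≡ tag0 a × a ∈c x × a ∈c y)
    common (e∈x , e∈y) with tag0-or-tag1 e
    ... | a , inj₁ refl = a , refl , trans (sym (bit-tag0-embed x a)) e∈x , trans (sym (bit-tag0-embed y a)) e∈y
    ... | a , inj₂ refl = ⊥-elim (padding-disjoint a x≢y
                            (trans (sym (bit-tag1-embed x a)) e∈x) (trans (sym (bit-tag1-embed y a)) e∈y))

  embed-⊆ : ∀ {Y : ℕ → Bool} x → (∀ a → a ∈c x → Y a ≡ true) → ∀ e → e ∈c embed x →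
            (Σ[ a ∈ ℕ ] (e ≡ tag0 a × Y a ≡ true)) ⊎ (Σ[ a ∈ ℕ ] e ≡ tag1 a)
  embed-⊆ x x⊆Y e e∈ with tag0-or-tag1 e
  ... | a , inj₁ refl = inj₁ (a , refl , x⊆Y a (trans (sym (bit-tag0-embed x a)) e∈))
  ... | a , inj₂ refl = inj₂ (a , refl)

  image : (ℕ → Bool) → ℕ → Bool
  image X z = X (decode z) ∧ ⌊ embed (decode z) ≟ z ⌋

  image-elim : ∀ X z → image X z ≡ true → Σ[ x ∈ ℕ ] (X x ≡ true × embed x ≡ z)
  image-elim X z with X (decode z) in x∈X | embed (decode z) ≟ z
  ... | true  | yes ι∘decode≡id = λ _ → decode z , x∈X , ι∘decode≡id
  ... | true  | no  _           = λ ()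
  ... | false | _               = λ ()

  image-intro : ∀ X x → X x ≡ true → image X (embed x) ≡ true
  image-intro X x x∈X rewrite decode-embed x | x∈X with embed x ≟ embed x
  ... | yes _    = refl
  ... | no ιx≢ιx = ⊥-elim (ιx≢ιx refl)

  image-⊆ : ∀ {Y : ℕ → Bool} X → (∀ x → X x ≡ true → ∀ a → a ∈c x → Y a ≡ true) →
            (∀ x → X x ≡ true → card x ≤ n) → ∀ z → image X z ≡ true →
            (card z ≡ n) ×
            (∀ e → e ∈c z → (Σ[ a ∈ ℕ ] (e ≡ tag0 a × Y a ≡ true)) ⊎ (Σ[ a ∈ ℕ ] e ≡ tag1 a))
  image-⊆ X X⊆Y X≤n z z∈image with image-elim X z z∈image
  ... | x , x∈X , refl = card-embed x (X≤n x x∈X) , embed-⊆ x (X⊆Y x x∈X)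

  tag0-∈-embed : ∀ {Y : ℕ → Bool} x → (∀ a → a ∈c x → Y a ≡ true) →
                 ∀ a → a ∈c x ⇔ (tag0 a ∈c embed x × Y a ≡ true)
  tag0-∈-embed x x⊆Y a = mk⇔ (λ a∈x → trans (bit-tag0-embed x a) a∈x , x⊆Y a a∈x)
                              (λ (a∈ιx , _) → trans (sym (bit-tag0-embed x a)) a∈ιx)

mainTheorem1 : (Y : ℕ → Bool) (n : ℕ) →
    Σ[ Φ ∈ ((ℕ → Bool) → ℕ → Bool) ] Σ[ ι ∈ ((ℕ → Bool) → ℕ → ℕ) ]
    ((X : ℕ → Bool) →
      (∀ x → X x ≡ true → ∀ a → a ∈c x → Y a ≡ true) →
      (∀ x → X x ≡ true → card x ≤ n) →
      (∀ z → Φ X z ≡ true →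
        (card z ≡ n) ×
        (∀ e → e ∈c z → (Σ[ a ∈ ℕ ] (e ≡ tag0 a × Y a ≡ true)) ⊎ (Σ[ a ∈ ℕ ] e ≡ tag1 a)))
      × (∀ x → X x ≡ true → Φ X (ι X x) ≡ true)
      × (∀ x y → X x ≡ true → X y ≡ true → ι X x ≡ ι X y → x ≡ y)
      × (∀ z → Φ X z ≡ true → Σ[ x ∈ ℕ ] (X x ≡ true × ι X x ≡ z))
      × (∀ x → X x ≡ true → ∀ a → (a ∈c x ⇔ (tag0 a ∈c ι X x × Y a ≡ true)))
      × (∀ (X₀ : ℕ → Set) → (∀ x → X₀ x → X x ≡ true) →
          (Sunflower X₀ ⇔ Sunflower (λ z → Σ[ x ∈ ℕ ] (X₀ x × ι X x ≡ z))))
      × (∀ x y → X x ≡ true → X y ≡ true → x ≢ y → ∀ e →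
          ((e ∈c ι X x × e ∈c ι X y) ⇔ (Σ[ a ∈ ℕ ] (e ≡ tag0 a × a ∈c x × a ∈c y)))))
mainTheorem1 Y n = image , (λ _ → embed) , λ X X⊆Y X≤n →
    image-⊆ X X⊆Y X≤n
  , image-intro X
  , (λ _ _ _ _ → embed-injective)
  , image-elim X
  , (λ x x∈X → tag0-∈-embed x (X⊆Y x x∈X))
  , (λ X₀ _ → Sunflower-image embed tag0 embed-injective tag0-injective embed-∩ X₀)
  , (λ x y _ _ → embed-∩ x y)
  where open Embedding n
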